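{- Up to isomorphism, the only minimal coloring of the nonzero rational numbers for the equation $x_0+2x_1=4x_2$ is $c_{2,3}$.
   Context: A coloring of the nonzero rationals is minimal for an equation if it has no monochromatic solution (a solution in nonzero rationals, variables not necessarily distinct, all of the same color) and uses as few colors as possible. For a nonzero rational $q$, $v_2(q)$ is the exponent of $2$ in $q$ (i.e. $q=2^v a/b$ with $a,b$ odd integers, and $v_2(q)=v$). The coloring $c_{2,3}\colon\mathbb{Q}\setminus\{0\}\to\{0,1,2\}$ is given by $c_{2,3}(q)\equiv v_2(q)\pmod 3$. Two colorings $c_1\colon S\to C_1$, $c_2\colon S\to C_2$ are isomorphic if there is a bijection $\phi\colon C_2\to C_1$ with $c_1=\phi\circ c_2$. -}

module Defs where

open import Data.Nat as ℕ using (ℕ; zero; suc; _≤_)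
open import Data.Nat.DivMod as NDM using ()
open import Data.Integer as ℤ using (ℤ)
open import Data.Integer.DivMod using (_%ℕ_)
open import Data.Rational as ℚ using (ℚ; 0ℚ)
open import Data.Fin using (Fin)
open import Data.Product using (Σ; _×_; proj₁)
open import Relation.Binary.PropositionalEquality using (_≡_)
open import Relation.Nullary using (¬_)
open import Function.Bundles using (_⤖_; Bijection)
open import Data.Bool using (if_then_else_)
open import Relation.Nullary.Decidable using (⌊_⌋)

ℚ* : Set
ℚ* = Σ ℚ ℚ.NonZero

-- 2-adic valuation of a natural number (with v₂ 0 = 0, irrelevant here),
-- computed with fuel n (enough, since each step halves n).
v₂ℕ-go : ℕ → ℕ → ℕ
v₂ℕ-go zero    n = 0
v₂ℕ-go (suc f) zero = 0
v₂ℕ-go (suc f) (suc m) =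
  if ⌊ (suc m NDM.% 2) ℕ.≟ 0 ⌋ then suc (v₂ℕ-go f (suc m NDM./ 2)) else 0

v₂ℕ : ℕ → ℕ
v₂ℕ n = v₂ℕ-go n n

v₂ : ℚ → ℤ
v₂ q = ℤ.+ v₂ℕ ℤ.∣ ℚ.numerator q ∣ ℤ.- ℤ.+ v₂ℕ (ℚ.denominatorℕ q)

c₂₃ : ℚ* → Fin 3
c₂₃ q = (v₂ (proj₁ q) %ℕ 3) NDM.mod 3

2ℚ 4ℚ : ℚ
2ℚ = ℤ.+ 2 ℚ./ 1
4ℚ = ℤ.+ 4 ℚ./ 1

IsSolution : ℚ* → ℚ* → ℚ* → Set
IsSolution x₀ x₁ x₂ = proj₁ x₀ ℚ.+ 2ℚ ℚ.* proj₁ x₁ ≡ 4ℚ ℚ.* proj₁ x₂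

NoMonoSolution : ∀ {k} → (ℚ* → Fin k) → Set
NoMonoSolution c = ∀ x₀ x₁ x₂ → IsSolution x₀ x₁ x₂ →
  ¬ (c x₀ ≡ c x₁ × c x₁ ≡ c x₂)

IsMinimal : ∀ k → (ℚ* → Fin k) → Set
IsMinimal k c = NoMonoSolution c ×
  (∀ m (c′ : ℚ* → Fin m) → NoMonoSolution c′ → k ≤ m)

Isomorphic : ∀ {k l} → (ℚ* → Fin k) → (ℚ* → Fin l) → Set
Isomorphic {k} {l} c₁ c₂ =
  Σ (Fin l ⤖ Fin k) λ φ → ∀ q → c₁ q ≡ Bijection.to φ (c₂ q)

-- Scaling a solution of x₀ + 2x₁ = 4x₂ by y gives a solution, so a colouring c without
-- monochromatic solutions satisfies c(2y) ≠ c(y) (2y + 2y = 4y), and the solutions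
-- (2,3,2), (4,4,3) show that 2y, 3y, 4y get three distinct colours. With exactly three
-- colours, a short chain of forced colours gives c(4y) ≠ c(y); hence c(8y) = c(y),
-- c(uy) = c(y) for odd u and c(−y) = c(y), so c(q) only depends on v₂(q) mod 3 and any
-- two such colourings differ by a permutation of the colours.
-- Conversely, clearing denominators in a monochromatic solution of c₂₃ gives three
-- integers with sum zero whose 2-adic valuations are pairwise distinct (they are
-- v₂(xᵢ) + i + const, with all v₂(xᵢ) congruent mod 3); but a sum with a unique term of
-- smallest valuation is odd after dividing by that power of 2, hence nonzero.
module Submission where

open import Defs
open import Data.Nat as ℕ using (ℕ; zero; suc; _^_; _<_; _≤_; s≤s)
import Data.Nat.Properties as ℕ
open import Data.Nat.DivMod using (_%_; _/_; _mod_; m≡m%n+[m/n]*n; m%n<n; m<n⇒m%n≡m)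
open import Data.Nat.Divisibility using (_∣_; _∣?_; divides; ∣1⇒≡1)
open import Data.Nat.Coprimality using (Coprime)
open import Data.Integer as ℤ using (ℤ; +_; -[1+_]; +[1+_]; 0ℤ; 1ℤ)
import Data.Integer.Properties as ℤ
open import Data.Integer.DivMod using (_%ℕ_; _/ℕ_; n%ℕd<d; a≡a%ℕn+[a/ℕn]*n)
open import Data.Integer.Solver renaming (module +-*-Solver to ℤ-Solver)
open import Data.Rational as ℚ using (ℚ; mkℚ; 0ℚ; 1ℚ; ↥_; ↧_; ↧ₙ_)
import Data.Rational.Properties as ℚ
open import Data.Rational.Literals using (fromℤ)
open import Data.Rational.Solver renaming (module +-*-Solver to ℚ-Solver)
open import Data.Rational.Unnormalised using (*≡*)
import Data.Rational.Unnormalised.Properties as ℚᵘ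
open import Data.Fin using (Fin; zero; suc; toℕ; punchOut)
import Data.Fin.Properties as Fin
open import Data.Vec using (_∷_; []; lookup)
open import Data.Product using (_×_; ∃-syntax; _,_; proj₁; proj₂)
open import Data.Sum using (inj₁; inj₂)
open import Function using (_∘_)
open import Function.Bundles using (_⤖_; mk⤖; Bijection)
open import Function.Construct.Composition using (_⤖-∘_)
open import Function.Construct.Symmetry using (⤖-sym)
open import Function.Definitions using (Injective; Surjective)
open import Relation.Binary.Definitions using (tri<; tri≈; tri>)
open import Relation.Binary.PropositionalEquality
open import Relation.Nullary using (¬_; yes; no; contradiction)
open import Relation.Nullary.Decidable using (from-no)

odd-split : ∀ n → n % 2 ≢ 0 → n ≡ suc (2 ℕ.* (n / 2))
odd-split n r≢0 with n % 2 | m%n<n n 2 | m≡m%n+[m/n]*n n 2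
... | 0           | _             | _       = contradiction refl r≢0
... | 1           | _             | n≡1+h*2 = trans n≡1+h*2 (cong suc (ℕ.*-comm (n / 2) 2))
... | suc (suc _) | s≤s (s≤s ()) | _

even-split : ∀ n → n % 2 ≡ 0 → n ≡ 2 ℕ.* (n / 2)
even-split n r≡0 =
  trans (m≡m%n+[m/n]*n n 2) (trans (cong (ℕ._+ (n / 2) ℕ.* 2) r≡0) (ℕ.*-comm (n / 2) 2))

v₂ℕ-go-odd-part : ∀ f m → m < f → ∃[ k ] suc m ≡ 2 ^ v₂ℕ-go f (suc m) ℕ.* suc (2 ℕ.* k)
v₂ℕ-go-odd-part (suc f) m (s≤s m≤f) with suc m % 2 ℕ.≟ 0
... | no  r≢0 = suc m / 2 , trans (odd-split (suc m) r≢0) (sym (ℕ.+-identityʳ _))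
... | yes r≡0 with suc m / 2 | even-split (suc m) r≡0
...   | zero  | ()
...   | suc h | m+1≡2h+2 with v₂ℕ-go-odd-part f h h<f
  where
  h<f : h < f
  h<f = ℕ.<-≤-trans (subst (h <_) (sym (ℕ.suc-injective m+1≡2h+2)) (ℕ.m<m+n h (s≤s ℕ.z≤n))) m≤f
...     | k , h+1≡2ᵛo =
  k , trans m+1≡2h+2 (trans (cong (2 ℕ.*_) h+1≡2ᵛo) (sym (ℕ.*-assoc 2 (2 ^ v₂ℕ-go f (suc h)) _)))

v₂ℕ-odd-part : ∀ n → ∃[ k ] suc n ≡ 2 ^ v₂ℕ (suc n) ℕ.* suc (2 ℕ.* k)
v₂ℕ-odd-part n = v₂ℕ-go-odd-part (suc n) n ℕ.≤-refl

distinct₃⇒lookup-injective : ∀ {a} {A : Set a} {x y z : A} → x ≢ y → x ≢ z → y ≢ z →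
                             Injective _≡_ _≡_ (lookup (x ∷ y ∷ z ∷ []))
distinct₃⇒lookup-injective x≢y x≢z y≢z {zero}           {zero}           _ = refl
distinct₃⇒lookup-injective x≢y x≢z y≢z {zero}           {suc zero}       e = contradiction e x≢y
distinct₃⇒lookup-injective x≢y x≢z y≢z {zero}           {suc (suc zero)} e = contradiction e x≢z
distinct₃⇒lookup-injective x≢y x≢z y≢z {suc zero}       {zero}           e = contradiction (sym e) x≢y
distinct₃⇒lookup-injective x≢y x≢z y≢z {suc zero}       {suc zero}       _ = refl
distinct₃⇒lookup-injective x≢y x≢z y≢z {suc zero}       {suc (suc zero)} e = contradiction e y≢z
distinct₃⇒lookup-injective x≢y x≢z y≢z {suc (suc zero)} {zero}           e = contradiction (sym e) x≢z
distinct₃⇒lookup-injective x≢y x≢z y≢z {suc (suc zero)} {suc zero}       e = contradiction (sym e) y≢z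
distinct₃⇒lookup-injective x≢y x≢z y≢z {suc (suc zero)} {suc (suc zero)} _ = refl

injective⇒surjective : ∀ {n} {f : Fin n → Fin n} → Injective _≡_ _≡_ f → Surjective _≡_ _≡_ f
injective⇒surjective {suc n} {f} f-inj y with Fin.any? (λ x → f x Fin.≟ y)
... | yes (x , fx≡y) = x , λ { refl → fx≡y }
... | no  ∄x         = contradiction (Fin.injective⇒≤ g-inj) ℕ.1+n≰n
  where
  g : Fin (suc n) → Fin n
  g x = punchOut {i = y} (λ y≡fx → ∄x (x , sym y≡fx))
  g-inj : Injective _≡_ _≡_ g
  g-inj = f-inj ∘ Fin.punchOut-injective {i = y} _ _

remaining-element : ∀ {a b d e : Fin 3} → a ≢ b → a ≢ d → b ≢ d → e ≢ b → e ≢ d → e ≡ a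
remaining-element a≢b a≢d b≢d e≢b e≢d
  with injective⇒surjective (distinct₃⇒lookup-injective a≢b a≢d b≢d) _
... | zero           , hit = sym (hit refl)
... | suc zero       , hit = contradiction (sym (hit refl)) e≢b
... | suc (suc zero) , hit = contradiction (sym (hit refl)) e≢d

*-nonZero : ∀ p q → ℚ.NonZero p → ℚ.NonZero q → ℚ.NonZero (p ℚ.* q)
*-nonZero p q p≢0 q≢0 = ℚ.≢-nonZero {p ℚ.* q} λ pq≡0 →
  ℕ.NonZero.nonZero (subst ℚ.NonZero (p≡0 pq≡0) p≢0)
  where
  instance
    q≢0′ : ℚ.NonZero q
    q≢0′ = q≢0
  p≡0 : p ℚ.* q ≡ 0ℚ → p ≡ 0ℚ
  p≡0 pq≡0 = begin
    p                      ≡⟨ sym (ℚ.*-identityʳ p) ⟩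
    p ℚ.* 1ℚ               ≡⟨ cong (p ℚ.*_) (sym (ℚ.*-inverseʳ q)) ⟩
    p ℚ.* (q ℚ.* ℚ.1/ q)   ≡⟨ sym (ℚ.*-assoc p q (ℚ.1/ q)) ⟩
    (p ℚ.* q) ℚ.* ℚ.1/ q   ≡⟨ cong (ℚ._* ℚ.1/ q) pq≡0 ⟩
    0ℚ ℚ.* ℚ.1/ q          ≡⟨ ℚ.*-zeroˡ (ℚ.1/ q) ⟩
    0ℚ                     ∎
    where open ≡-Reasoning

nonZero-irrelevant : ∀ {q} (p p′ : ℚ.NonZero q) → p ≡ p′
nonZero-irrelevant {mkℚ +[1+ _ ] _ _} _ _ = refl
nonZero-irrelevant {mkℚ -[1+ _ ] _ _} _ _ = refl

infixr 7 _·_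

_·_ : ℚ* → ℚ* → ℚ*
(p , p≢0) · (q , q≢0) = p ℚ.* q , *-nonZero p q p≢0 q≢0

⟨_⟩ : ∀ n → {{ℕ.NonZero n}} → ℚ*
⟨ n ⟩ {{n≢0}} = fromℤ (+ n) , n≢0

-⟨_⟩ : ∀ n → {{ℕ.NonZero n}} → ℚ*
-⟨ suc n ⟩ = fromℤ -[1+ n ] , _

odd : ℕ → ℚ*
odd m = ⟨ suc (2 ℕ.* m) ⟩

pow2 : ℕ → ℚ*
pow2 n = ⟨ 2 ^ n ⟩ {{ℕ.m^n≢0 2 n}}

fromℕ : ℕ → ℚ
fromℕ n = fromℤ (+ n)

fromℤ-+ : ∀ i j → fromℤ (i ℤ.+ j) ≡ fromℤ i ℚ.+ fromℤ j
fromℤ-+ i j = ℚ.toℚᵘ-injective (ℚᵘ.≃-sym (ℚᵘ.≃-trans (ℚ.toℚᵘ-homo-+ (fromℤ i) (fromℤ j))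
  (*≡* (cong (ℤ._* 1ℤ) (cong₂ ℤ._+_ (ℤ.*-identityʳ i) (ℤ.*-identityʳ j))))))

fromℤ-* : ∀ i j → fromℤ (i ℤ.* j) ≡ fromℤ i ℚ.* fromℤ j
fromℤ-* i j = ℚ.toℚᵘ-injective (ℚᵘ.≃-sym (ℚ.toℚᵘ-homo-* (fromℤ i) (fromℤ j)))

fromℕ-* : ∀ m n → fromℕ (m ℕ.* n) ≡ fromℕ m ℚ.* fromℕ n
fromℕ-* m n = trans (cong fromℤ (ℤ.pos-* m n)) (fromℤ-* (+ m) (+ n))

odd-suc : ∀ m → proj₁ (odd (suc m)) ≡ proj₁ (odd m) ℚ.+ 2ℚ
odd-suc m = trans (cong fromℕ 2m+3≡[2m+1]+2) (fromℤ-+ (+ suc (2 ℕ.* m)) (+ 2))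
  where
  2m+3≡[2m+1]+2 : suc (2 ℕ.* suc m) ≡ suc (2 ℕ.* m) ℕ.+ 2
  2m+3≡[2m+1]+2 = cong suc (trans (ℕ.*-suc 2 m) (ℕ.+-comm 2 (2 ℕ.* m)))

pow2-+ : ∀ m n → proj₁ (pow2 (m ℕ.+ n)) ≡ proj₁ (pow2 m · pow2 n)
pow2-+ m n = trans (cong fromℕ (ℕ.^-distribˡ-+-* 2 m n)) (fromℕ-* (2 ^ m) (2 ^ n))

mkℚ-*-denominator : ∀ m d .(c : Coprime m (suc d)) → mkℚ (+ m) d c ℚ.* fromℕ (suc d) ≡ fromℕ m
mkℚ-*-denominator m d c = ℚ.toℚᵘ-injective (ℚᵘ.≃-trans (ℚ.toℚᵘ-homo-* (mkℚ (+ m) d c) (fromℕ (suc d)))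
  (*≡* (trans (ℤ.*-identityʳ _) (cong (λ n → + m ℤ.* + n) (sym (ℕ.*-identityʳ (suc d)))))))

-- For q = 2ᵃ(2k+1) / 2ᵇ(2l+1) we have v₂(q) = a − b ≡ a + 2b (mod 3), and 2^(a+2b) is the
-- power of two reached from q by the colour-preserving scalings by 8ᵇ and by odd numbers.
exponent : ℚ* → ℕ
exponent (q , _) = v₂ℕ ℤ.∣ ↥ q ∣ ℕ.+ (b ℕ.+ b)
  where
  b : ℕ
  b = v₂ℕ (↧ₙ q)

clear-denominator : ∀ {n d k l} .(c : Coprime (suc n) (suc d)) (p : ℚ.NonZero (mkℚ +[1+ n ] d c)) →
  let a = v₂ℕ (suc n); b = v₂ℕ (suc d) in
  suc n ≡ 2 ^ a ℕ.* suc (2 ℕ.* k) → suc d ≡ 2 ^ b ℕ.* suc (2 ℕ.* l) →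
  proj₁ (pow2 b · pow2 b · pow2 b · odd l · (mkℚ +[1+ n ] d c , p)) ≡ proj₁ (odd k · pow2 (a ℕ.+ (b ℕ.+ b)))
clear-denominator {n} {d} {k} {l} c p n≡2ᵃ[2k+1] d≡2ᵇ[2l+1] = begin
  B ℚ.* (B ℚ.* (B ℚ.* (L ℚ.* Q)))  ≡⟨ solve 3 (λ B L Q → B :* (B :* (B :* (L :* Q))) := (B :* B) :* (Q :* (B :* L))) refl B L Q ⟩
  (B ℚ.* B) ℚ.* (Q ℚ.* (B ℚ.* L))  ≡⟨ cong ((B ℚ.* B) ℚ.*_) Q[BL]≡AK ⟩
  (B ℚ.* B) ℚ.* (A ℚ.* K)          ≡⟨ solve 3 (λ A B K → (B :* B) :* (A :* K) := K :* (A :* (B :* B))) refl A B K ⟩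
  K ℚ.* (A ℚ.* (B ℚ.* B))          ≡⟨ cong (K ℚ.*_) (sym (trans (pow2-+ a (b ℕ.+ b)) (cong (A ℚ.*_) (pow2-+ b b)))) ⟩
  K ℚ.* proj₁ (pow2 (a ℕ.+ (b ℕ.+ b))) ∎
  where
  open ≡-Reasoning
  open ℚ-Solver
  a b : ℕ
  a = v₂ℕ (suc n)
  b = v₂ℕ (suc d)
  A B K L Q : ℚ
  A = fromℕ (2 ^ a)
  B = fromℕ (2 ^ b)
  K = proj₁ (odd k)
  L = proj₁ (odd l)
  Q = mkℚ +[1+ n ] d c
  Q[BL]≡AK : Q ℚ.* (B ℚ.* L) ≡ A ℚ.* K
  Q[BL]≡AK = begin
    Q ℚ.* (B ℚ.* L)      ≡⟨ cong (Q ℚ.*_) (trans (sym (fromℕ-* (2 ^ b) _)) (cong fromℕ (sym d≡2ᵇ[2l+1]))) ⟩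
    Q ℚ.* fromℕ (suc d)  ≡⟨ mkℚ-*-denominator (suc n) d c ⟩
    fromℕ (suc n)        ≡⟨ trans (cong fromℕ n≡2ᵃ[2k+1]) (fromℕ-* (2 ^ a) _) ⟩
    A ℚ.* K              ∎

·-solution : ∀ a b d → IsSolution a b d → ∀ x → IsSolution (a · x) (b · x) (d · x)
·-solution (a , _) (b , _) (d , _) sol (x , _) = begin
  a ℚ.* x ℚ.+ 2ℚ ℚ.* (b ℚ.* x)  ≡⟨ solve 3 (λ a b x → a :* x :+ con 2ℚ :* (b :* x) := (a :+ con 2ℚ :* b) :* x) refl a b x ⟩
  (a ℚ.+ 2ℚ ℚ.* b) ℚ.* x        ≡⟨ cong (ℚ._* x) sol ⟩
  (4ℚ ℚ.* d) ℚ.* x              ≡⟨ ℚ.*-assoc 4ℚ d x ⟩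
  4ℚ ℚ.* (d ℚ.* x)              ∎
  where
  open ≡-Reasoning
  open ℚ-Solver

-- 2-adic valuations of integers

record HasV₂ (i : ℤ) (e : ℕ) : Set where
  constructor _,_
  field
    t : ℤ
    i≡2ᵉ[1+2t] : i ≡ + (2 ^ e) ℤ.* (1ℤ ℤ.+ + 2 ℤ.* t)

HasV₂-* : ∀ {i j e f} → HasV₂ i e → HasV₂ j f → HasV₂ (i ℤ.* j) (e ℕ.+ f)
HasV₂-* {e = e} {f} (t , refl) (s , refl) = t ℤ.+ s ℤ.+ + 2 ℤ.* t ℤ.* s , (begin
  (P ℤ.* (1ℤ ℤ.+ + 2 ℤ.* t)) ℤ.* (Q ℤ.* (1ℤ ℤ.+ + 2 ℤ.* s))
    ≡⟨ solve 4 (λ P Q t s → (P :* (con 1ℤ :+ con (+ 2) :* t)) :* (Q :* (con 1ℤ :+ con (+ 2) :* s))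
                          := (P :* Q) :* (con 1ℤ :+ con (+ 2) :* (t :+ s :+ con (+ 2) :* t :* s))) refl P Q t s ⟩
  (P ℤ.* Q) ℤ.* (1ℤ ℤ.+ + 2 ℤ.* (t ℤ.+ s ℤ.+ + 2 ℤ.* t ℤ.* s))
    ≡⟨ cong (ℤ._* _) (trans (sym (ℤ.pos-* (2 ^ e) (2 ^ f))) (cong +_ (sym (ℕ.^-distribˡ-+-* 2 e f)))) ⟩
  + (2 ^ (e ℕ.+ f)) ℤ.* (1ℤ ℤ.+ + 2 ℤ.* (t ℤ.+ s ℤ.+ + 2 ℤ.* t ℤ.* s)) ∎)
  where
  open ≡-Reasoning
  open ℤ-Solver
  P Q : ℤ
  P = + (2 ^ e)
  Q = + (2 ^ f)

HasV₂-neg : ∀ {i e} → HasV₂ i e → HasV₂ (ℤ.- i) e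
HasV₂-neg {e = e} (t , refl) = ℤ.- 1ℤ ℤ.- t ,
  solve 2 (λ P t → :- (P :* (con 1ℤ :+ con (+ 2) :* t)) := P :* (con 1ℤ :+ con (+ 2) :* (:- con 1ℤ :+ :- t))) refl (+ (2 ^ e)) t
  where open ℤ-Solver

HasV₂-suc : ∀ n → HasV₂ (+ suc n) (v₂ℕ (suc n))
HasV₂-suc n with v₂ℕ-odd-part n
... | k , n+1≡2ᵃ[2k+1] = + k , (begin
  + suc n                                  ≡⟨ cong +_ n+1≡2ᵃ[2k+1] ⟩
  + (2 ^ a ℕ.* suc (2 ℕ.* k))              ≡⟨ ℤ.pos-* (2 ^ a) (suc (2 ℕ.* k)) ⟩
  + (2 ^ a) ℤ.* (1ℤ ℤ.+ + (2 ℕ.* k))       ≡⟨ cong (λ 2k → + (2 ^ a) ℤ.* (1ℤ ℤ.+ 2k)) (ℤ.pos-* 2 k) ⟩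
  + (2 ^ a) ℤ.* (1ℤ ℤ.+ + 2 ℤ.* + k)       ∎)
  where
  open ≡-Reasoning
  a : ℕ
  a = v₂ℕ (suc n)

1+2*≢0 : ∀ t → 1ℤ ℤ.+ + 2 ℤ.* t ≢ 0ℤ
1+2*≢0 t 1+2t≡0 = contradiction (∣1⇒≡1 (divides ℤ.∣ ℤ.- t ∣ 1≡∣-t∣*2)) λ ()
  where
  open ℤ-Solver
  1≡2*[-t] : 1ℤ ≡ + 2 ℤ.* (ℤ.- t)
  1≡2*[-t] = trans (solve 1 (λ t → con 1ℤ := (con 1ℤ :+ con (+ 2) :* t) :+ con (+ 2) :* (:- t)) refl t)
                   (trans (cong (ℤ._+ (+ 2 ℤ.* (ℤ.- t))) 1+2t≡0) (ℤ.+-identityˡ (+ 2 ℤ.* (ℤ.- t))))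
  1≡∣-t∣*2 : 1 ≡ ℤ.∣ ℤ.- t ∣ ℕ.* 2
  1≡∣-t∣*2 = trans (cong ℤ.∣_∣ 1≡2*[-t]) (trans (ℤ.abs-* (+ 2) (ℤ.- t)) (ℕ.*-comm 2 ℤ.∣ ℤ.- t ∣))

2^[1+e+p] : ∀ e p → + (2 ^ (suc e ℕ.+ p)) ≡ + (2 ^ e) ℤ.* (+ 2 ℤ.* + (2 ^ p))
2^[1+e+p] e p = begin
  + (2 ^ (suc e ℕ.+ p))               ≡⟨ cong +_ (ℕ.^-distribˡ-+-* 2 (suc e) p) ⟩
  + (2 ℕ.* 2 ^ e ℕ.* 2 ^ p)           ≡⟨ ℤ.pos-* (2 ℕ.* 2 ^ e) (2 ^ p) ⟩
  + (2 ℕ.* 2 ^ e) ℤ.* + (2 ^ p)       ≡⟨ cong (ℤ._* + (2 ^ p)) (ℤ.pos-* 2 (2 ^ e)) ⟩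
  + 2 ℤ.* + (2 ^ e) ℤ.* + (2 ^ p)     ≡⟨ solve 2 (λ P X → con (+ 2) :* P :* X := P :* (con (+ 2) :* X)) refl (+ (2 ^ e)) (+ (2 ^ p)) ⟩
  + (2 ^ e) ℤ.* (+ 2 ℤ.* + (2 ^ p))   ∎
  where
  open ≡-Reasoning
  open ℤ-Solver

HasV₂⇒≢0 : ∀ {i e} → HasV₂ i e → i ≢ 0ℤ
HasV₂⇒≢0 {e = e} (t , refl) i≡0 with ℤ.i*j≡0⇒i≡0∨j≡0 (+ (2 ^ e)) i≡0
... | inj₁ 2ᵉ≡0 = contradiction (ℕ.m^n≡0⇒m≡0 2 e (cong ℤ.∣_∣ 2ᵉ≡0)) λ ()
... | inj₂ odd≡0 = 1+2*≢0 t odd≡0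

HasV₂-sum≢0 : ∀ {i j k e f g} → HasV₂ i e → HasV₂ j f → HasV₂ k g → e < f → e < g → i ℤ.+ j ℤ.+ k ≢ 0ℤ
HasV₂-sum≢0 {e = e} (t , refl) (s , refl) (r , refl) e<f e<g
  with p , refl ← ℕ.m≤n⇒∃[o]m+o≡n e<f | q , refl ← ℕ.m≤n⇒∃[o]m+o≡n e<g
  = HasV₂⇒≢0 {e = e} (t ℤ.+ X ℤ.* o₁ ℤ.+ Y ℤ.* o₂ , factored)
  where
  open ℤ-Solver
  P X Y o₁ o₂ : ℤ
  P = + (2 ^ e)
  X = + (2 ^ p)
  Y = + (2 ^ q)
  o₁ = 1ℤ ℤ.+ + 2 ℤ.* s
  o₂ = 1ℤ ℤ.+ + 2 ℤ.* r
  factored : P ℤ.* (1ℤ ℤ.+ + 2 ℤ.* t) ℤ.+ + (2 ^ (suc e ℕ.+ p)) ℤ.* o₁ ℤ.+ + (2 ^ (suc e ℕ.+ q)) ℤ.* o₂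
           ≡ P ℤ.* (1ℤ ℤ.+ + 2 ℤ.* (t ℤ.+ X ℤ.* o₁ ℤ.+ Y ℤ.* o₂))
  factored = trans
    (cong₂ (λ A B → P ℤ.* (1ℤ ℤ.+ + 2 ℤ.* t) ℤ.+ A ℤ.* o₁ ℤ.+ B ℤ.* o₂) (2^[1+e+p] e p) (2^[1+e+p] e q))
    (solve 6 (λ P X Y t o₁ o₂ → P :* (con 1ℤ :+ con (+ 2) :* t) :+ (P :* (con (+ 2) :* X)) :* o₁ :+ (P :* (con (+ 2) :* Y)) :* o₂
                               := P :* (con 1ℤ :+ con (+ 2) :* (t :+ X :* o₁ :+ Y :* o₂)))
             refl P X Y t o₁ o₂)

distinct-HasV₂-sum≢0 : ∀ {i j k e f g} → HasV₂ i e → HasV₂ j f → HasV₂ k g →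
                       e ≢ f → e ≢ g → f ≢ g → i ℤ.+ j ℤ.+ k ≢ 0ℤ
distinct-HasV₂-sum≢0 {i} {j} {k} {e} {f} {g} vi vj vk e≢f e≢g f≢g
  with ℕ.<-cmp e f | ℕ.<-cmp e g | ℕ.<-cmp f g
... | tri≈ _ e≡f _ | _            | _            = contradiction e≡f e≢f
... | _            | tri≈ _ e≡g _ | _            = contradiction e≡g e≢g
... | _            | _            | tri≈ _ f≡g _ = contradiction f≡g f≢g
... | tri< e<f _ _ | tri< e<g _ _ | _            = HasV₂-sum≢0 vi vj vk e<f e<g
... | tri> _ _ f<e | _            | tri< f<g _ _ =
  HasV₂-sum≢0 vj vi vk f<e f<g ∘ trans (cong (ℤ._+ k) (ℤ.+-comm j i))
... | _            | tri> _ _ g<e | tri> _ _ g<f =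
  HasV₂-sum≢0 vk vi vj g<e g<f ∘ trans (solve 3 (λ i j k → k :+ i :+ j := i :+ j :+ k) refl i j k)
  where open ℤ-Solver
... | tri< e<f _ _ | tri> _ _ g<e | tri< f<g _ _ = contradiction (ℕ.<-trans e<f f<g) (ℕ.<-asym g<e)
... | tri> _ _ f<e | tri< e<g _ _ | tri> _ _ g<f = contradiction (ℕ.<-trans e<g g<f) (ℕ.<-asym f<e)

residue₃ : ℤ → Fin 3
residue₃ z = (z %ℕ 3) mod 3

residue₃-+ : ∀ z k → residue₃ (z ℤ.+ + k) ≡ residue₃ z → 3 ∣ k
residue₃-+ z k same-residue = divides ℤ.∣ q′ ℤ.- q ∣ (trans (cong ℤ.∣_∣ k≡[q′-q]*3) (ℤ.abs-* (q′ ℤ.- q) (+ 3)))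
  where
  q q′ : ℤ
  q = z /ℕ 3
  q′ = (z ℤ.+ + k) /ℕ 3
  r : ℕ
  r = z %ℕ 3
  toℕ-residue₃ : ∀ x → toℕ (residue₃ x) ≡ x %ℕ 3
  toℕ-residue₃ x = trans (Fin.toℕ-fromℕ< (m%n<n (x %ℕ 3) 3)) (m<n⇒m%n≡m (n%ℕd<d x 3))
  same-%ℕ : (z ℤ.+ + k) %ℕ 3 ≡ r
  same-%ℕ = trans (sym (toℕ-residue₃ (z ℤ.+ + k))) (trans (cong toℕ same-residue) (toℕ-residue₃ z))
  k≡[q′-q]*3 : + k ≡ (q′ ℤ.- q) ℤ.* + 3
  k≡[q′-q]*3 = begin
    + k                                            ≡⟨ solve 2 (λ z k → k := (z :+ k) :+ :- z) refl z (+ k) ⟩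
    (z ℤ.+ + k) ℤ.- z                              ≡⟨ cong₂ ℤ._-_ (a≡a%ℕn+[a/ℕn]*n (z ℤ.+ + k) 3) (a≡a%ℕn+[a/ℕn]*n z 3) ⟩
    (+ _ ℤ.+ q′ ℤ.* + 3) ℤ.- (+ r ℤ.+ q ℤ.* + 3)   ≡⟨ cong (λ r′ → (+ r′ ℤ.+ q′ ℤ.* + 3) ℤ.- (+ r ℤ.+ q ℤ.* + 3)) same-%ℕ ⟩
    (+ r ℤ.+ q′ ℤ.* + 3) ℤ.- (+ r ℤ.+ q ℤ.* + 3)   ≡⟨ solve 3 (λ r q′ q → (r :+ q′ :* con (+ 3)) :+ :- (r :+ q :* con (+ 3)) := (q′ :+ :- q) :* con (+ 3)) refl (+ r) q′ q ⟩
    (q′ ℤ.- q) ℤ.* + 3                             ∎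
    where
    open ≡-Reasoning
    open ℤ-Solver

cross-difference : ∀ a b a′ b′ k s → a ℕ.+ (b′ ℕ.+ s) ≡ (k ℕ.+ a′) ℕ.+ (b ℕ.+ s) →
                   + a ℤ.- + b ≡ (+ a′ ℤ.- + b′) ℤ.+ + k
cross-difference a b a′ b′ k s eq = begin
  + a ℤ.- + b                                              ≡⟨ solve 4 (λ a b b′ s → a :+ :- b := (a :+ (b′ :+ s)) :+ :- (b′ :+ (b :+ s))) refl (+ a) (+ b) (+ b′) (+ s) ⟩
  (+ a ℤ.+ (+ b′ ℤ.+ + s)) ℤ.- (+ b′ ℤ.+ (+ b ℤ.+ + s))       ≡⟨ cong (ℤ._- (+ b′ ℤ.+ (+ b ℤ.+ + s))) (cong +_ eq) ⟩
  ((+ k ℤ.+ + a′) ℤ.+ (+ b ℤ.+ + s)) ℤ.- (+ b′ ℤ.+ (+ b ℤ.+ + s)) ≡⟨ solve 5 (λ k a′ b b′ s → ((k :+ a′) :+ (b :+ s)) :+ :- (b′ :+ (b :+ s)) := (a′ :+ :- b′) :+ k) refl (+ k) (+ a′) (+ b) (+ b′) (+ s) ⟩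
  (+ a′ ℤ.- + b′) ℤ.+ + k                                  ∎
  where
  open ≡-Reasoning
  open ℤ-Solver

exponent-clash : ∀ a b a′ b′ k s → ¬ 3 ∣ k → residue₃ (+ a ℤ.- + b) ≡ residue₃ (+ a′ ℤ.- + b′) →
                 a ℕ.+ (b′ ℕ.+ s) ≢ (k ℕ.+ a′) ℕ.+ (b ℕ.+ s)
exponent-clash a b a′ b′ k s 3∤k same-residue eq = 3∤k (residue₃-+ (+ a′ ℤ.- + b′) k
  (subst (λ v → residue₃ v ≡ residue₃ (+ a′ ℤ.- + b′)) (cross-difference a b a′ b′ k s eq) same-residue))

cleared-equation : ∀ x₀ x₁ x₂ → x₀ ℚ.+ 2ℚ ℚ.* x₁ ≡ 4ℚ ℚ.* x₂ →
  ↥ x₀ ℤ.* (↧ x₁ ℤ.* ↧ x₂) ℤ.+ (+ 2 ℤ.* ↥ x₁) ℤ.* (↧ x₀ ℤ.* ↧ x₂) ℤ.+ ℤ.- ((+ 4 ℤ.* ↥ x₂) ℤ.* (↧ x₀ ℤ.* ↧ x₁)) ≡ 0ℤ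
cleared-equation x₀@(mkℚ n₀ d₀ _) x₁@(mkℚ n₁ d₁ _) x₂@(mkℚ n₂ d₂ _) eq with
  ℚᵘ.≃-trans (ℚᵘ.≃-sym (ℚᵘ.≃-trans (ℚ.toℚᵘ-homo-+ x₀ (2ℚ ℚ.* x₁)) (ℚᵘ.+-congʳ (ℚ.toℚᵘ x₀) (ℚ.toℚᵘ-homo-* 2ℚ x₁))))
             (ℚᵘ.≃-trans (ℚ.toℚᵘ-cong eq) (ℚ.toℚᵘ-homo-* 4ℚ x₂))
... | *≡* cross = begin
  n₀ ℤ.* (D₁ ℤ.* D₂) ℤ.+ (+ 2 ℤ.* n₁) ℤ.* (D₀ ℤ.* D₂) ℤ.+ ℤ.- ((+ 4 ℤ.* n₂) ℤ.* (D₀ ℤ.* D₁))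
    ≡⟨ solve 6 (λ n₀ n₁ n₂ D₀ D₁ D₂ → n₀ :* (D₁ :* D₂) :+ (con (+ 2) :* n₁) :* (D₀ :* D₂) :+ :- ((con (+ 4) :* n₂) :* (D₀ :* D₁))
                := (n₀ :* D₁ :+ (con (+ 2) :* n₁) :* D₀) :* D₂ :+ :- ((con (+ 4) :* n₂) :* (D₀ :* D₁))) refl n₀ n₁ n₂ D₀ D₁ D₂ ⟩
  (n₀ ℤ.* D₁ ℤ.+ (+ 2 ℤ.* n₁) ℤ.* D₀) ℤ.* D₂ ℤ.- (+ 4 ℤ.* n₂) ℤ.* (D₀ ℤ.* D₁)
    ≡⟨ cong (ℤ._- (+ 4 ℤ.* n₂) ℤ.* (D₀ ℤ.* D₁)) cross′ ⟩
  (+ 4 ℤ.* n₂) ℤ.* (D₀ ℤ.* D₁) ℤ.- (+ 4 ℤ.* n₂) ℤ.* (D₀ ℤ.* D₁)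
    ≡⟨ ℤ.+-inverseʳ ((+ 4 ℤ.* n₂) ℤ.* (D₀ ℤ.* D₁)) ⟩
  0ℤ ∎
  where
  open ≡-Reasoning
  open ℤ-Solver
  D₀ D₁ D₂ : ℤ
  D₀ = + suc d₀
  D₁ = + suc d₁
  D₂ = + suc d₂
  -- The denominators of the ℚᵘ products come out as suc (d + 0).
  cross′ : (n₀ ℤ.* D₁ ℤ.+ (+ 2 ℤ.* n₁) ℤ.* D₀) ℤ.* D₂ ≡ (+ 4 ℤ.* n₂) ℤ.* (D₀ ℤ.* D₁)
  cross′ = subst₂ (λ d₁′ d₂′ → (n₀ ℤ.* + suc d₁′ ℤ.+ (+ 2 ℤ.* n₁) ℤ.* D₀) ℤ.* + suc d₂′ ≡ (+ 4 ℤ.* n₂) ℤ.* (D₀ ℤ.* + suc d₁′))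
                  (ℕ.+-identityʳ d₁) (ℕ.+-identityʳ d₂) cross

HasV₂-numerator : ∀ (x : ℚ*) → HasV₂ (↥ proj₁ x) (v₂ℕ ℤ.∣ ↥ proj₁ x ∣)
HasV₂-numerator (mkℚ +[1+ n ] _ _ , _) = HasV₂-suc n
HasV₂-numerator (mkℚ -[1+ n ] _ _ , _) = HasV₂-neg (HasV₂-suc n)

c₂₃-noMono : NoMonoSolution c₂₃
c₂₃-noMono x₀ x₁ x₂ sol (c₀≡c₁ , c₁≡c₂) = distinct-HasV₂-sum≢0 V₀ V₁ (HasV₂-neg V₂) e₀≢e₁ e₀≢e₂ e₁≢e₂
  (cleared-equation (proj₁ x₀) (proj₁ x₁) (proj₁ x₂) sol)
  where
  a₀ a₁ a₂ b₀ b₁ b₂ : ℕ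
  a₀ = v₂ℕ ℤ.∣ ↥ proj₁ x₀ ∣
  a₁ = v₂ℕ ℤ.∣ ↥ proj₁ x₁ ∣
  a₂ = v₂ℕ ℤ.∣ ↥ proj₁ x₂ ∣
  b₀ = v₂ℕ (↧ₙ (proj₁ x₀))
  b₁ = v₂ℕ (↧ₙ (proj₁ x₁))
  b₂ = v₂ℕ (↧ₙ (proj₁ x₂))
  D : ∀ x → HasV₂ (↧ proj₁ x) (v₂ℕ (↧ₙ (proj₁ x)))
  D (mkℚ _ d _ , _) = HasV₂-suc d
  V₀ : HasV₂ (↥ proj₁ x₀ ℤ.* (↧ proj₁ x₁ ℤ.* ↧ proj₁ x₂)) (a₀ ℕ.+ (b₁ ℕ.+ b₂))
  V₀ = HasV₂-* (HasV₂-numerator x₀) (HasV₂-* (D x₁) (D x₂))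
  V₁ : HasV₂ ((+ 2 ℤ.* ↥ proj₁ x₁) ℤ.* (↧ proj₁ x₀ ℤ.* ↧ proj₁ x₂)) ((1 ℕ.+ a₁) ℕ.+ (b₀ ℕ.+ b₂))
  V₁ = HasV₂-* (HasV₂-* {e = 1} (+ 0 , refl) (HasV₂-numerator x₁)) (HasV₂-* (D x₀) (D x₂))
  V₂ : HasV₂ ((+ 4 ℤ.* ↥ proj₁ x₂) ℤ.* (↧ proj₁ x₀ ℤ.* ↧ proj₁ x₁)) ((2 ℕ.+ a₂) ℕ.+ (b₀ ℕ.+ b₁))
  V₂ = HasV₂-* (HasV₂-* {e = 2} (+ 0 , refl) (HasV₂-numerator x₂)) (HasV₂-* (D x₀) (D x₁))
  e₀≢e₁ : a₀ ℕ.+ (b₁ ℕ.+ b₂) ≢ (1 ℕ.+ a₁) ℕ.+ (b₀ ℕ.+ b₂)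
  e₀≢e₁ = exponent-clash a₀ b₀ a₁ b₁ 1 b₂ (from-no (3 ∣? 1)) c₀≡c₁
  e₀≢e₂ : a₀ ℕ.+ (b₁ ℕ.+ b₂) ≢ (2 ℕ.+ a₂) ℕ.+ (b₀ ℕ.+ b₁)
  e₀≢e₂ = exponent-clash a₀ b₀ a₂ b₂ 2 b₁ (from-no (3 ∣? 2)) (trans c₀≡c₁ c₁≡c₂)
        ∘ trans (cong (a₀ ℕ.+_) (ℕ.+-comm b₂ b₁))
  e₁≢e₂ : (1 ℕ.+ a₁) ℕ.+ (b₀ ℕ.+ b₂) ≢ (2 ℕ.+ a₂) ℕ.+ (b₀ ℕ.+ b₁)
  e₁≢e₂ = exponent-clash a₁ b₁ a₂ b₂ 1 b₀ (from-no (3 ∣? 1)) c₁≡c₂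
        ∘ subst₂ (λ s s′ → a₁ ℕ.+ s ≡ (1 ℕ.+ a₂) ℕ.+ s′) (ℕ.+-comm b₀ b₂) (ℕ.+-comm b₀ b₁) ∘ ℕ.suc-injective

-- Colourings without monochromatic solutions

colour-cong : ∀ {k} (c : ℚ* → Fin k) {x y : ℚ*} → proj₁ x ≡ proj₁ y → c x ≡ c y
colour-cong c {q , p} {.q , p′} refl = cong (λ p → c (q , p)) (nonZero-irrelevant {q} p p′)

module NoMonochromatic {k} {c : ℚ* → Fin k} (noMono : NoMonoSolution c) where

  forbidden : ∀ a b d → IsSolution a b d → ∀ y → c (a · y) ≡ c (b · y) → c (b · y) ≢ c (d · y)
  forbidden a b d sol y ab bd = noMono _ _ _ (·-solution a b d sol y) (ab , bd)

  1·-keeps-colour : ∀ y → c (⟨ 1 ⟩ · y) ≡ c y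
  1·-keeps-colour y = colour-cong c (ℚ.*-identityˡ (proj₁ y))

  ·-assoc-colour : ∀ a b d → proj₁ a ℚ.* proj₁ b ≡ proj₁ d → ∀ y → c (a · b · y) ≡ c (d · y)
  ·-assoc-colour (a , _) (b , _) (d , _) ab≡d (y , _) =
    colour-cong c (trans (sym (ℚ.*-assoc a b y)) (cong (ℚ._* y) ab≡d))

  2·-changes-colour : ∀ y → c (⟨ 2 ⟩ · y) ≢ c y
  2·-changes-colour y c2≡c =
    forbidden ⟨ 2 ⟩ ⟨ 1 ⟩ ⟨ 1 ⟩ refl y (trans c2≡c (sym (1·-keeps-colour y))) refl

  3·≢2· : ∀ y → c (⟨ 3 ⟩ · y) ≢ c (⟨ 2 ⟩ · y)
  3·≢2· y c3≡c2 = forbidden ⟨ 2 ⟩ ⟨ 3 ⟩ ⟨ 2 ⟩ refl y (sym c3≡c2) c3≡c2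

  3·≢4· : ∀ y → c (⟨ 3 ⟩ · y) ≢ c (⟨ 4 ⟩ · y)
  3·≢4· y c3≡c4 = forbidden ⟨ 4 ⟩ ⟨ 4 ⟩ ⟨ 3 ⟩ refl y refl (sym c3≡c4)

  4·≢2· : ∀ y → c (⟨ 4 ⟩ · y) ≢ c (⟨ 2 ⟩ · y)
  4·≢2· y c4≡c2 = 2·-changes-colour (⟨ 2 ⟩ · y) (trans (·-assoc-colour ⟨ 2 ⟩ ⟨ 2 ⟩ ⟨ 4 ⟩ refl y) c4≡c2)

  at-least-three-colours : 3 ≤ k
  at-least-three-colours = Fin.injective⇒≤ (distinct₃⇒lookup-injective
    (λ c2≡c3 → 3·≢2· y (sym c2≡c3)) (λ c2≡c4 → 4·≢2· y (sym c2≡c4)) (3·≢4· y))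
    where
    y : ℚ*
    y = ⟨ 1 ⟩

module ThreeColouring {c : ℚ* → Fin 3} (noMono : NoMonoSolution c) where

  open NoMonochromatic noMono
  open ℚ-Solver

  -- If c(4y) = c(y), the solutions (4,4,3), (2,3,2), (4,6,4), (6,3,3), (−4,4,1), (−4,6,2),
  -- (8,4,4), (8,8,6) force c(6y) = c(2y) and c(−4y) = c(8y) = c(3y), so (−4,8,3) is monochromatic.
  4·-changes-colour : ∀ y → c (⟨ 4 ⟩ · y) ≢ c y
  4·-changes-colour y c4≡c = forbidden -⟨ 4 ⟩ ⟨ 8 ⟩ ⟨ 3 ⟩ refl y (trans c-4≡c3 (sym c8≡c3)) c8≡c3
    where
    C : ℚ* → Fin 3
    C a = c (a · y)
    c4≡c1 : C ⟨ 4 ⟩ ≡ C ⟨ 1 ⟩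
    c4≡c1 = trans c4≡c (sym (1·-keeps-colour y))
    c1≢c2 : C ⟨ 1 ⟩ ≢ C ⟨ 2 ⟩
    c1≢c2 c1≡c2 = 2·-changes-colour y (trans (sym c1≡c2) (1·-keeps-colour y))
    c3≢c1 : C ⟨ 3 ⟩ ≢ C ⟨ 1 ⟩
    c3≢c1 c3≡c1 = 3·≢4· y (trans c3≡c1 (sym c4≡c1))
    c3≢c2 : C ⟨ 3 ⟩ ≢ C ⟨ 2 ⟩
    c3≢c2 = 3·≢2· y
    c6≡c2 : C ⟨ 6 ⟩ ≡ C ⟨ 2 ⟩
    c6≡c2 = remaining-element (λ e → c1≢c2 (sym e)) (λ e → c3≢c2 (sym e)) (λ e → c3≢c1 (sym e))
      (λ c6≡c1 → forbidden ⟨ 4 ⟩ ⟨ 6 ⟩ ⟨ 4 ⟩ refl y (trans c4≡c1 (sym c6≡c1)) (trans c6≡c1 (sym c4≡c1)))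
      (λ c6≡c3 → forbidden ⟨ 6 ⟩ ⟨ 3 ⟩ ⟨ 3 ⟩ refl y c6≡c3 refl)
    c-4≡c3 : C -⟨ 4 ⟩ ≡ C ⟨ 3 ⟩
    c-4≡c3 = remaining-element c3≢c1 c3≢c2 c1≢c2
      (λ c-4≡c1 → forbidden -⟨ 4 ⟩ ⟨ 4 ⟩ ⟨ 1 ⟩ refl y (trans c-4≡c1 (sym c4≡c1)) c4≡c1)
      (λ c-4≡c2 → forbidden -⟨ 4 ⟩ ⟨ 6 ⟩ ⟨ 2 ⟩ refl y (trans c-4≡c2 (sym c6≡c2)) c6≡c2)
    c8≡c3 : C ⟨ 8 ⟩ ≡ C ⟨ 3 ⟩
    c8≡c3 = remaining-element c3≢c1 c3≢c2 c1≢c2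
      (λ c8≡c1 → forbidden ⟨ 8 ⟩ ⟨ 4 ⟩ ⟨ 4 ⟩ refl y (trans c8≡c1 (sym c4≡c1)) refl)
      (λ c8≡c2 → forbidden ⟨ 8 ⟩ ⟨ 8 ⟩ ⟨ 6 ⟩ refl y refl (trans c8≡c2 (sym c6≡c2)))

  remaining-colour : ∀ y z → c z ≢ c (⟨ 2 ⟩ · y) → c z ≢ c (⟨ 4 ⟩ · y) → c z ≡ c y
  remaining-colour y z = remaining-element
    (λ e → 2·-changes-colour y (sym e)) (λ e → 4·-changes-colour y (sym e)) (λ e → 4·≢2· y (sym e))

  8·-keeps-colour : ∀ y → c (⟨ 8 ⟩ · y) ≡ c y
  8·-keeps-colour y = remaining-colour y (⟨ 8 ⟩ · y)
    (λ c8≡c2 → 4·-changes-colour (⟨ 2 ⟩ · y) (trans (·-assoc-colour ⟨ 4 ⟩ ⟨ 2 ⟩ ⟨ 8 ⟩ refl y) c8≡c2))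
    (λ c8≡c4 → 2·-changes-colour (⟨ 4 ⟩ · y) (trans (·-assoc-colour ⟨ 2 ⟩ ⟨ 4 ⟩ ⟨ 8 ⟩ refl y) c8≡c4))

  -- Induction along the solutions ((2m+1)·4, 4, 2m+3) and (16, (2m+1)·2, 2m+5).
  odd·-keeps-colour : ∀ m y → c (odd m · y) ≡ c y
  odd·-keeps-colour zero    y = 1·-keeps-colour y
  odd·-keeps-colour (suc m) y = remaining-colour y (odd (suc m) · y) (≢2y m) ≢4y
    where
    ≢4y : c (odd (suc m) · y) ≢ c (⟨ 4 ⟩ · y)
    ≢4y e = forbidden (odd m · ⟨ 4 ⟩) ⟨ 4 ⟩ (odd (suc m)) sol y
      (trans (sym (·-assoc-colour (odd m) ⟨ 4 ⟩ (odd m · ⟨ 4 ⟩) refl y)) (odd·-keeps-colour m (⟨ 4 ⟩ · y)))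
      (sym e)
      where
      sol : IsSolution (odd m · ⟨ 4 ⟩) ⟨ 4 ⟩ (odd (suc m))
      sol = trans (solve 1 (λ o → o :* con 4ℚ :+ con 2ℚ :* con 4ℚ := con 4ℚ :* (o :+ con 2ℚ)) refl (proj₁ (odd m)))
                  (cong (4ℚ ℚ.*_) (sym (odd-suc m)))
    ≢2y : ∀ m → c (odd (suc m) · y) ≢ c (⟨ 2 ⟩ · y)
    ≢2y zero     = 3·≢2· y
    ≢2y (suc m) e = forbidden ⟨ 16 ⟩ (odd m · ⟨ 2 ⟩) (odd (suc (suc m))) sol y
      (trans c16≡c2 (sym c[2o]≡c2))
      (trans c[2o]≡c2 (sym e))
      where
      c16≡c2 : c (⟨ 16 ⟩ · y) ≡ c (⟨ 2 ⟩ · y)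
      c16≡c2 = trans (sym (·-assoc-colour ⟨ 8 ⟩ ⟨ 2 ⟩ ⟨ 16 ⟩ refl y)) (8·-keeps-colour (⟨ 2 ⟩ · y))
      c[2o]≡c2 : c ((odd m · ⟨ 2 ⟩) · y) ≡ c (⟨ 2 ⟩ · y)
      c[2o]≡c2 = trans (sym (·-assoc-colour (odd m) ⟨ 2 ⟩ (odd m · ⟨ 2 ⟩) refl y)) (odd·-keeps-colour m (⟨ 2 ⟩ · y))
      sol : IsSolution ⟨ 16 ⟩ (odd m · ⟨ 2 ⟩) (odd (suc (suc m)))
      sol = begin
        16ℚ ℚ.+ 2ℚ ℚ.* (o ℚ.* 2ℚ)   ≡⟨ solve 1 (λ o → con 16ℚ :+ con 2ℚ :* (o :* con 2ℚ) := con 4ℚ :* ((o :+ con 2ℚ) :+ con 2ℚ)) refl o ⟩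
        4ℚ ℚ.* ((o ℚ.+ 2ℚ) ℚ.+ 2ℚ) ≡⟨ cong (4ℚ ℚ.*_) (sym (trans (odd-suc (suc m)) (cong (ℚ._+ 2ℚ) (odd-suc m)))) ⟩
        4ℚ ℚ.* proj₁ (odd (suc (suc m))) ∎
        where
        open ≡-Reasoning
        o 16ℚ : ℚ
        o = proj₁ (odd m)
        16ℚ = proj₁ ⟨ 16 ⟩

  -- The solutions (8, −2, 1) and (−4, 8, 3) give c(y) ≠ c(−2y) and c(y) ≠ c(−4y).
  -1·-keeps-colour : ∀ y → c (-⟨ 1 ⟩ · y) ≡ c y
  -1·-keeps-colour y = sym (remaining-colour (-⟨ 1 ⟩ · y) y
    (λ c≡c[-2] → forbidden ⟨ 8 ⟩ -⟨ 2 ⟩ ⟨ 1 ⟩ refl y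
       (trans (8·-keeps-colour y) (trans c≡c[-2] (·-assoc-colour ⟨ 2 ⟩ -⟨ 1 ⟩ -⟨ 2 ⟩ refl y)))
       (trans (sym (·-assoc-colour ⟨ 2 ⟩ -⟨ 1 ⟩ -⟨ 2 ⟩ refl y)) (trans (sym c≡c[-2]) (sym (1·-keeps-colour y)))))
    (λ c≡c[-4] → forbidden -⟨ 4 ⟩ ⟨ 8 ⟩ ⟨ 3 ⟩ refl y
       (trans (sym (·-assoc-colour ⟨ 4 ⟩ -⟨ 1 ⟩ -⟨ 4 ⟩ refl y)) (trans (sym c≡c[-4]) (sym (8·-keeps-colour y))))
       (trans (8·-keeps-colour y) (sym (odd·-keeps-colour 1 y)))))

  pow2³·-keeps-colour : ∀ b y → c (pow2 b · pow2 b · pow2 b · y) ≡ c y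
  pow2³·-keeps-colour zero    y = colour-cong c (solve 1 (λ y → con 1ℚ :* (con 1ℚ :* (con 1ℚ :* y)) := y) refl (proj₁ y))
  pow2³·-keeps-colour (suc b) y =
    trans (colour-cong c 8B³y) (trans (8·-keeps-colour _) (pow2³·-keeps-colour b y))
    where
    B : ℚ
    B = proj₁ (pow2 b)
    8B³y : proj₁ (pow2 (suc b) · pow2 (suc b) · pow2 (suc b) · y) ≡ proj₁ (⟨ 8 ⟩ · pow2 b · pow2 b · pow2 b · y)
    8B³y = trans (cong (λ B′ → B′ ℚ.* (B′ ℚ.* (B′ ℚ.* proj₁ y))) (pow2-+ 1 b))
      (solve 2 (λ B y → (con 2ℚ :* B) :* ((con 2ℚ :* B) :* ((con 2ℚ :* B) :* y)) := con 8ℚ :* (B :* (B :* (B :* y)))) refl B (proj₁ y))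
      where
      8ℚ : ℚ
      8ℚ = proj₁ ⟨ 8 ⟩

  colour≡pow2-colour⁺ : ∀ n d .(cop : Coprime (suc n) (suc d)) p →
    c (mkℚ +[1+ n ] d cop , p) ≡ c (pow2 (v₂ℕ (suc n) ℕ.+ (v₂ℕ (suc d) ℕ.+ v₂ℕ (suc d))))
  colour≡pow2-colour⁺ n d cop p with v₂ℕ-odd-part n | v₂ℕ-odd-part d
  ... | k , n≡ | l , d≡ = begin
    c q                                        ≡⟨ sym (odd·-keeps-colour l q) ⟩
    c (odd l · q)                              ≡⟨ sym (pow2³·-keeps-colour b _) ⟩
    c (pow2 b · pow2 b · pow2 b · odd l · q)   ≡⟨ colour-cong c (clear-denominator {k = k} {l} cop p n≡ d≡) ⟩
    c (odd k · pow2 (a ℕ.+ (b ℕ.+ b)))         ≡⟨ odd·-keeps-colour k _ ⟩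
    c (pow2 (a ℕ.+ (b ℕ.+ b)))                 ∎
    where
    open ≡-Reasoning
    q : ℚ*
    q = (mkℚ +[1+ n ] d cop , p)
    a b : ℕ
    a = v₂ℕ (suc n)
    b = v₂ℕ (suc d)

  colour≡pow2-colour : ∀ q → c q ≡ c (pow2 (exponent q))
  colour≡pow2-colour (mkℚ +[1+ n ] d cop , p) = colour≡pow2-colour⁺ n d cop p
  colour≡pow2-colour q@(mkℚ -[1+ n ] d cop , p) = begin
    c q                         ≡⟨ sym (-1·-keeps-colour q) ⟩
    c (-⟨ 1 ⟩ · q)              ≡⟨ colour-cong c (solve 1 (λ q → con (proj₁ -⟨ 1 ⟩) :* q := :- q) refl (proj₁ q)) ⟩
    c (mkℚ +[1+ n ] d cop , _)  ≡⟨ colour≡pow2-colour⁺ n d cop _ ⟩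
    c (pow2 (exponent q))       ∎
    where open ≡-Reasoning

  pow2-suc-colour : ∀ n → c (pow2 (suc n)) ≡ c (⟨ 2 ⟩ · pow2 n)
  pow2-suc-colour n = colour-cong c (pow2-+ 1 n)

  pow2-colour-period : ∀ n → c (pow2 (3 ℕ.+ n)) ≡ c (pow2 n)
  pow2-colour-period n = trans (colour-cong c (pow2-+ 3 n)) (8·-keeps-colour (pow2 n))

  pow2-colours : Fin 3 ⤖ Fin 3
  pow2-colours = mk⤖ (injective , injective⇒surjective injective)
    where
    injective : Injective _≡_ _≡_ (lookup (c (pow2 0) ∷ c (pow2 1) ∷ c (pow2 2) ∷ []))
    injective = distinct₃⇒lookup-injective
      (λ e → 2·-changes-colour (pow2 0) (trans (sym (pow2-suc-colour 0)) (sym e)))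
      (λ e → 4·-changes-colour (pow2 0) (trans (sym (colour-cong c (pow2-+ 2 0))) (sym e)))
      (λ e → 2·-changes-colour (pow2 1) (trans (sym (pow2-suc-colour 1)) (sym e)))

colourings-isomorphic : ∀ {c c′ : ℚ* → Fin 3} → NoMonoSolution c → NoMonoSolution c′ → Isomorphic c c′
colourings-isomorphic {c} {c′} noMono noMono′ = φ , λ q → begin
  c q                                 ≡⟨ T.colour≡pow2-colour q ⟩
  c (pow2 (exponent q))               ≡⟨ on-pow2 (exponent q) ⟩
  to φ (c′ (pow2 (exponent q)))       ≡⟨ cong (to φ) (sym (T′.colour≡pow2-colour q)) ⟩
  to φ (c′ q)                         ∎
  where
  open ≡-Reasoning
  open Bijection using (to)
  module T = ThreeColouring noMono
  module T′ = ThreeColouring noMono′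
  φ : Fin 3 ⤖ Fin 3
  φ = T.pow2-colours ⤖-∘ ⤖-sym T′.pow2-colours
  from∘to : ∀ j → to (⤖-sym T′.pow2-colours) (to T′.pow2-colours j) ≡ j
  from∘to j = Bijection.injective T′.pow2-colours (proj₂ (Bijection.surjective T′.pow2-colours _) refl)
  on-pow2 : ∀ n → c (pow2 n) ≡ to φ (c′ (pow2 n))
  on-pow2 0 = cong (to T.pow2-colours) (sym (from∘to zero))
  on-pow2 1 = cong (to T.pow2-colours) (sym (from∘to (suc zero)))
  on-pow2 2 = cong (to T.pow2-colours) (sym (from∘to (suc (suc zero))))
  on-pow2 (suc (suc (suc n))) =
    trans (T.pow2-colour-period n) (trans (on-pow2 n) (cong (to φ) (sym (T′.pow2-colour-period n))))

proposition17 : (IsMinimal 3 c₂₃ × (∀ k (c : ℚ* → Fin k) → IsMinimal k c → Isomorphic c c₂₃))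
proposition17 = (c₂₃-noMono , λ _ _ → NoMonochromatic.at-least-three-colours) , minimal⇒isomorphic
  where
  three-colours⇒isomorphic : ∀ {k} → k ≡ 3 → (c : ℚ* → Fin k) → NoMonoSolution c → Isomorphic c c₂₃
  three-colours⇒isomorphic refl c noMono = colourings-isomorphic noMono c₂₃-noMono
  minimal⇒isomorphic : ∀ k (c : ℚ* → Fin k) → IsMinimal k c → Isomorphic c c₂₃
  minimal⇒isomorphic k c (noMono , minimal) = three-colours⇒isomorphic
    (ℕ.≤-antisym (minimal 3 c₂₃ c₂₃-noMono) (NoMonochromatic.at-least-three-colours noMono)) c noMono
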